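{- Let $n,k\in\mathbb{Z}^+$, let $p_j$ denote the $j$-th prime, $P_{k,n}=\{p_n,\dots,p_{n+k-1}\}$ and $N=p_n p_{n+1}\cdots p_{n+k-1}$. Define the unary promise problem $\mathtt{L^{k,n}}=(\mathtt{L^{k,n}_{yes}},\mathtt{L^{k,n}_{no}})$ by $\mathtt{L^{k,n}_{yes}}=\{a^m\mid m\equiv 0\pmod N\}$ and $\mathtt{L^{k,n}_{no}}=\{a^m\mid m\bmod p_j\in[\frac{p_j}{8},\frac{3p_j}{8}]\cup[\frac{5p_j}{8},\frac{7p_j}{8}]\text{ for at least }\frac{2k}{3}\text{ different }p_j\in P_{k,n}\}$. Then there is a probabilistic finite automaton with $O(k(n+k)\log(n+k))$ states (implied constant independent of $n,k$) that solves $\mathtt{L^{k,n}}$ with one-sided error bound $\frac13$, i.e. it accepts every yes-instance with probability $1$ and accepts every no-instance with probability at most $\frac13$.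
   Context: A probabilistic finite automaton (PFA) is $(Q,\Sigma,\{A_\sigma\}_{\sigma\in\Sigma},v_0,Q_a)$ with finite state set $Q$, column-stochastic matrices $A_\sigma$, stochastic initial vector $v_0$ and accepting set $Q_a$; on input $w=w_1\cdots w_\ell$ the final vector is $v_\ell=A_{w_\ell}\cdots A_{w_1}v_0$ and the acceptance probability is $\sum_{q_j\in Q_a}v_\ell(j)$. -}

module Defs where

open import Data.Nat as ℕ using (ℕ; zero; suc; _+_; _*_; _∸_; _%_; NonZero)
open import Data.Nat.Primality using (Prime; prime?)
open import Data.Nat.Divisibility using (_∣_)
open import Data.List using (List; length; filter; upTo)
open import Data.Fin using (Fin; zero; suc)
open import Data.Bool using (Bool; true; false; if_then_else_)
open import Data.Product using (_×_; ∃; ∃₂)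
open import Data.Sum using (_⊎_)
open import Data.List.Relation.Unary.Unique.Propositional using (Unique)
open import Data.List.Relation.Unary.All using (All)
import Data.Integer as ℤ
open import Data.Rational as ℚ using (ℚ; 0ℚ; 1ℚ)
open import Relation.Binary.PropositionalEquality using (_≡_)

sumFin : (s : ℕ) → (Fin s → ℚ) → ℚ
sumFin zero    f = 0ℚ
sumFin (suc s) f = f zero ℚ.+ sumFin s (λ i → f (suc i))

primesBelow : ℕ → ℕ
primesBelow q = length (filter prime? (upTo q))

-- q is the j-th prime (j ≥ 1; p_1 = 2)
IsNthPrime : ℕ → ℕ → Set
IsNthPrime j q = Prime q × primesBelow q ≡ j ∸ 1

IsPrimeEnum : (ℕ → ℕ) → Set
IsPrimeEnum p = ∀ j → 1 ℕ.≤ j → IsNthPrime j (p j)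

primeProd : (ℕ → ℕ) → ℕ → ℕ → ℕ
primeProd p n zero    = 1
primeProd p n (suc k) = p n * primeProd p (suc n) k

-- r = m mod q (written out: m = t*q + r with r < q) lies in
-- [q/8, 3q/8] ∪ [5q/8, 7q/8]
InBand : ℕ → ℕ → Set
InBand q m = ∃₂ λ t r → m ≡ t * q + r × r ℕ.< q ×
  ((q ℕ.≤ 8 * r × 8 * r ℕ.≤ 3 * q) ⊎ (5 * q ℕ.≤ 8 * r × 8 * r ℕ.≤ 7 * q))

LYes : (ℕ → ℕ) → ℕ → ℕ → ℕ → Set
LYes p n k m = primeProd p n k ∣ m

-- no-instances: m mod p_j in the band for at least 2k/3 distinct p_j ∈ P_{k,n}
-- (the p_j are distinct primes, so we count distinct indices j ∈ [n, n+k-1])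
LNo : (ℕ → ℕ) → ℕ → ℕ → ℕ → Set
LNo p n k m = ∃ λ (S : List ℕ) → Unique S ×
  All (λ j → n ℕ.≤ j × j ℕ.< n + k × InBand (p j) m) S ×
  2 * k ℕ.≤ 3 * length S

-- PFA over the unary alphabet {a}, with rational entries.
-- trans i j = entry (row i, column j) of the column-stochastic matrix A_a.
record PFA : Set where
  field
    states  : ℕ
    trans   : Fin states → Fin states → ℚ
    init    : Fin states → ℚ
    accept  : Fin states → Bool
    trans-nonneg : ∀ i j → 0ℚ ℚ.≤ trans i j
    trans-col    : ∀ j → sumFin states (λ i → trans i j) ≡ 1ℚ
    init-nonneg  : ∀ i → 0ℚ ℚ.≤ init i
    init-sum     : sumFin states init ≡ 1ℚ

  vec : ℕ → Fin states → ℚ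
  vec zero    = init
  vec (suc m) = λ i → sumFin states (λ j → trans i j ℚ.* vec m j)

  accProb : ℕ → ℚ
  accProb m = sumFin states (λ i → if accept i then vec m i else 0ℚ)

open PFA public

SolvesOneSided : PFA → (ℕ → Set) → (ℕ → Set) → Set
SolvesOneSided M Yes No =
  (∀ m → Yes m → accProb M m ≡ 1ℚ) × (∀ m → No m → accProb M m ℚ.≤ (ℤ.+ 1) ℚ./ 3)

module Submission where

-- The automaton picks one of k cycles uniformly at random, the i-th of length
-- p (n + i), walks along it one step per letter and accepts iff it is back at
-- the start, i.e. iff p (n + i) ∣ m.  It therefore accepts a^m with probability
-- #{i < k | p (n + i) ∣ m} / k: this is 1 when N ∣ m, and at most 1/3 on a
-- no-instance, since a residue in the band is nonzero for at least 2k/3 of the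
-- primes.  Each cycle is padded to B = 24 (n + k) ⌊log₂ (n + k)⌋ states, which
-- is enough by a Chebyshev-type estimate: every prime power dividing the central
-- binomial coefficient (2m choose m) is at most 2m (Kummer), so
-- 2 ^ m ≤ (2m choose m) ≤ (2m) ^ π(2m), which gives p j = O(j log j).

open import Defs hiding (trans)

open import Data.Nat.Base
open import Data.Nat.Properties
open import Data.Nat.Divisibility
open import Data.Nat.DivMod
open import Data.Nat.Primality
open import Data.Nat.Primality.Factorisation using (factorise; PrimeFactorisation)
open import Data.Nat.Combinatorics using (_C_; nCk≡n!/k![n-k]!; k![n∸k]!∣n!)
open import Data.Nat.Logarithm using (⌊log₂_⌋; ⌊log₂⌋-mono-≤; ⌊log₂[2^n]⌋≡n)
open import Data.Nat.Induction using (<-rec)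
open import Data.Nat.GeneralisedArithmetic using (fold)
open import Data.Nat.Tactic.RingSolver using (solve-∀)
open import Data.Bool.Base using (Bool; true; false; if_then_else_; not; _∧_)
open import Data.Bool.Properties using (∧-identityʳ)
open import Data.Fin.Base as Fin using (Fin; zero; suc; toℕ; fromℕ<; combine; remQuot; _↑ˡ_; _↑ʳ_)
open import Data.Fin.Properties as Fin using (toℕ-fromℕ<; remQuot-combine)
open import Data.List.Base using ([]; _∷_; length; filter; upTo; [_]; _++_)
open import Data.List.Properties using (upTo-∷ʳ; filter-++; length-++)
open import Data.List.Membership.Propositional using (_∈_)
open import Data.List.Membership.Propositional.Properties using (∈-filter⁺; ∈-upTo⁺)
open import Data.List.Relation.Unary.All as All using (All; []; _∷_)
open import Data.List.Relation.Unary.All.Properties using (all-filter)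
open import Data.List.Relation.Unary.AllPairs using ([]; _∷_)
open import Data.List.Relation.Unary.Any using (here; there)
open import Data.List.Relation.Unary.Unique.Propositional using (Unique)
import Data.Integer.Base as ℤ
open import Data.Rational as ℚ using (ℚ; 0ℚ; 1ℚ; 1/_)
import Data.Rational.Properties as ℚP
open import Algebra.Bundles using (CommutativeRing)
open CommutativeRing ℚP.+-*-commutativeRing using (semiring)
open import Algebra.Properties.Semiring.Sum semiring
  using (sum; sum-syntax; sum-cong-≗; sum-replicate; ∑-comm; *-distribˡ-sum; *-distribʳ-sum)
open import Algebra.Properties.Semiring.Mult semiring using (×-assoc-*; ×1-homo-*) renaming (_×_ to _·_)
open import Data.Product using (∃; ∃-syntax; ∃₂; _×_; _,_; proj₁; proj₂)
open import Data.Sum using (_⊎_; inj₁; inj₂; [_,_]′; map₂)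
open import Function.Base using (_∘_; id)
open import Relation.Nullary using (¬_; does; yes; no; contradiction)
open import Relation.Nullary.Decidable using (dec-true; dec-false)
open import Relation.Binary.PropositionalEquality hiding ([_])

-- Prime powers in factorials and central binomial coefficients

prime⇒2≤ : ∀ {q} → Prime q → 2 ≤ q
prime⇒2≤ {q} q-prime = nonTrivial⇒n>1 q {{prime⇒nonTrivial q-prime}}

^-monoʳ-∣ : ∀ q {a b} → a ≤ b → q ^ a ∣ q ^ b
^-monoʳ-∣ q {a} {b} a≤b = divides (q ^ (b ∸ a)) (begin
  q ^ b                 ≡⟨ cong (q ^_) (m∸n+n≡m a≤b) ⟨
  q ^ (b ∸ a + a)       ≡⟨ ^-distribˡ-+-* q (b ∸ a) a ⟩
  q ^ (b ∸ a) * q ^ a   ∎)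
  where open ≡-Reasoning

infix 4 _^_∥_
_^_∥_ : ℕ → ℕ → ℕ → Set
q ^ e ∥ n = ∃[ u ] n ≡ q ^ e * u × ¬ q ∣ u

module _ {q} (q-prime : Prime q) where

  private instance
    q≢0 : NonZero q
    q≢0 = prime⇒nonZero q-prime

  ∤-* : ∀ {a b} → ¬ q ∣ a → ¬ q ∣ b → ¬ q ∣ a * b
  ∤-* {a} {b} q∤a q∤b q∣ab = [ q∤a , q∤b ]′ (euclidsLemma a b q-prime q∣ab)

  ∤1 : ¬ q ∣ 1
  ∤1 q∣1 = <⇒≢ (prime⇒2≤ q-prime) (sym (∣1⇒≡1 q∣1))

  ∤-nonzero-digit : ∀ r t → 0 < r → r < q → ¬ q ∣ r + t * q
  ∤-nonzero-digit r t 0<r r<q q∣r+tq =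
    <⇒≱ r<q (∣⇒≤ {{>-nonZero 0<r}} (∣m+n∣m⇒∣n (subst (q ∣_) (+-comm r (t * q)) q∣r+tq) (n∣m*n t)))

  ^∣∧^∥⇒≤ : ∀ {n t g} → q ^ t ∣ n → q ^ g ∥ n → t ≤ g
  ^∣∧^∥⇒≤ {n} {t} {g} q^t∣n (u , refl , q∤u) with t ≤? g
  ... | yes t≤g = t≤g
  ... | no  t≰g = contradiction (*-cancelˡ-∣ (q ^ g) {{m^n≢0 q g}} q^g*q∣q^g*u) q∤u
    where
    q^g*q∣q^g*u : q ^ g * q ∣ q ^ g * u
    q^g*q∣q^g*u = ∣-trans (subst (_∣ q ^ t) (*-comm q (q ^ g)) (^-monoʳ-∣ q (≰⇒> t≰g))) q^t∣n

  factorial-split : ∀ a {d} → d < q → ∃[ w ] (d + a * q) ! ≡ q ^ a * (a ! * w) × ¬ q ∣ w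
  factorial-split zero    {zero}  _   = 1 , refl , ∤1
  factorial-split (suc a) {zero}  _   with factorial-split a (≤-reflexive (suc-pred q))
  ... | w , eq , q∤w = w , eq′ , q∤w
    where
    q+aq≡1+[q-1+aq] : q + a * q ≡ suc (pred q + a * q)
    q+aq≡1+[q-1+aq] = cong (_+ a * q) (sym (suc-pred q))
    shuffle : ∀ a q P F w → (q + a * q) * (P * (F * w)) ≡ (q * P) * ((F + a * F) * w)
    shuffle = solve-∀
    eq′ : (q + a * q) ! ≡ q ^ suc a * (suc a ! * w)
    eq′ = begin
      (q + a * q) !                              ≡⟨ cong _! q+aq≡1+[q-1+aq] ⟩
      suc (pred q + a * q) * (pred q + a * q) !  ≡⟨ cong₂ _*_ (sym q+aq≡1+[q-1+aq]) eq ⟩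
      (q + a * q) * (q ^ a * (a ! * w))          ≡⟨ shuffle a q (q ^ a) (a !) w ⟩
      q ^ suc a * (suc a ! * w)                  ∎
      where open ≡-Reasoning
  factorial-split a       {suc d} d<q with factorial-split a (<-trans (n<1+n d) d<q)
  ... | w , eq , q∤w = suc (d + a * q) * w , eq′ , ∤-* (∤-nonzero-digit (suc d) a z<s d<q) q∤w
    where
    shuffle : ∀ s P F w → s * (P * (F * w)) ≡ P * (F * (s * w))
    shuffle = solve-∀
    eq′ : (suc d + a * q) ! ≡ q ^ a * (a ! * (suc (d + a * q) * w))
    eq′ = begin
      suc (d + a * q) * (d + a * q) !          ≡⟨ cong (suc (d + a * q) *_) eq ⟩
      suc (d + a * q) * (q ^ a * (a ! * w))    ≡⟨ shuffle (suc (d + a * q)) (q ^ a) (a !) w ⟩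
      q ^ a * (a ! * (suc (d + a * q) * w))    ∎
      where open ≡-Reasoning

  legendre-step : ∀ a {e d n} → q ^ e ∥ a ! → d < q → n ≡ d + a * q → q ^ (a + e) ∥ n !
  legendre-step a {e} {d} (u , a!≡ , q∤u) d<q refl with factorial-split a d<q
  ... | w , eq , q∤w = u * w , eq′ , ∤-* q∤u q∤w
    where
    shuffle : ∀ P E u w → P * (E * u * w) ≡ (P * E) * (u * w)
    shuffle = solve-∀
    eq′ : (d + a * q) ! ≡ q ^ (a + e) * (u * w)
    eq′ = begin
      (d + a * q) !              ≡⟨ eq ⟩
      q ^ a * (a ! * w)          ≡⟨ cong (λ z → q ^ a * (z * w)) a!≡ ⟩
      q ^ a * (q ^ e * u * w)    ≡⟨ shuffle (q ^ a) (q ^ e) u w ⟩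
      q ^ a * q ^ e * (u * w)    ≡⟨ cong (_* (u * w)) (^-distribˡ-+-* q a e) ⟨
      q ^ (a + e) * (u * w)      ∎
      where open ≡-Reasoning

  -- g is the number of carries in the base-q addition x + x + c (Kummer); each
  -- carry happens below the leading digit of c + 2x, whence q ^ g ≤ c + 2x.
  CentralValuation : ℕ → ℕ → Set
  CentralValuation c x = ∃₂ λ e g →
    q ^ e ∥ x ! × q ^ (g + (e + e)) ∥ (c + (x + x)) ! × (g ≡ 0 ⊎ q ^ g ≤ c + (x + x))

  private
    c+2[r+aq]≡[c+2r]+2aq : ∀ c r a q → c + ((r + a * q) + (r + a * q)) ≡ (c + (r + r)) + (a + a) * q
    c+2[r+aq]≡[c+2r]+2aq = solve-∀

  central-valuation-no-carry : ∀ {c r a} → r < q → c + (r + r) < q →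
                               CentralValuation 0 a → CentralValuation c (r + a * q)
  central-valuation-no-carry {c} {r} {a} r<q s<q (e , g , ∥a! , ∥[2a]! , g-bound) =
    a + e , g , legendre-step a ∥a! r<q refl ,
    subst (λ z → q ^ z ∥ (c + (x + x)) !) (exponent a g e) (legendre-step (a + a) ∥[2a]! s<q (c+2[r+aq]≡[c+2r]+2aq c r a q)) ,
    map₂ (λ q^g≤2a → ≤-trans q^g≤2a 2a≤c+2x) g-bound
    where
    x = r + a * q
    exponent : ∀ a g e → (a + a) + (g + (e + e)) ≡ g + ((a + e) + (a + e))
    exponent = solve-∀
    a≤x : a ≤ x
    a≤x = ≤-trans (m≤m*n a q) (m≤n+m (a * q) r)
    2a≤c+2x : a + a ≤ c + (x + x)
    2a≤c+2x = ≤-trans (+-mono-≤ a≤x a≤x) (m≤n+m (x + x) c)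

  central-valuation-carry : ∀ {c r a} → c ≤ 1 → r < q → q ≤ c + (r + r) →
                            CentralValuation 1 a → CentralValuation c (r + a * q)
  central-valuation-carry {c} {r} {a} c≤1 r<q q≤s (e , g , ∥a! , ∥[1+2a]! , g-bound) =
    a + e , suc g , legendre-step a ∥a! r<q refl ,
    subst (λ z → q ^ z ∥ (c + (x + x)) !) (exponent a g e) (legendre-step (1 + (a + a)) ∥[1+2a]! d<q c+2x≡d+[1+2a]q) ,
    inj₂ q^[1+g]≤c+2x
    where
    open ≤-Reasoning
    x = r + a * q
    d = c + (r + r) ∸ q
    d<q : d < q
    d<q = m<n+o⇒m∸n<o (c + (r + r)) q (begin-strict
      c + (r + r)   ≤⟨ +-monoˡ-≤ (r + r) c≤1 ⟩
      suc r + r     <⟨ +-monoʳ-< (suc r) r<q ⟩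
      suc r + q     ≤⟨ +-monoˡ-≤ q r<q ⟩
      q + q         ∎)
    regroup : ∀ d q a → (d + q) + (a + a) * q ≡ d + (1 + (a + a)) * q
    regroup = solve-∀
    c+2x≡d+[1+2a]q : c + (x + x) ≡ d + (1 + (a + a)) * q
    c+2x≡d+[1+2a]q = trans (c+2[r+aq]≡[c+2r]+2aq c r a q)
      (trans (cong (_+ (a + a) * q) (sym (m∸n+n≡m q≤s))) (regroup d q a))
    exponent : ∀ a g e → (1 + (a + a)) + (g + (e + e)) ≡ suc g + ((a + e) + (a + e))
    exponent = solve-∀
    q^g≤1+2a : q ^ g ≤ 1 + (a + a)
    q^g≤1+2a = [ (λ { refl → s≤s z≤n }) , id ]′ g-bound
    q^[1+g]≤c+2x : q ^ suc g ≤ c + (x + x)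
    q^[1+g]≤c+2x = begin
      q * q ^ g              ≤⟨ *-monoʳ-≤ q q^g≤1+2a ⟩
      q * (1 + (a + a))      ≡⟨ *-comm q (1 + (a + a)) ⟩
      (1 + (a + a)) * q      ≤⟨ m≤n+m _ d ⟩
      d + (1 + (a + a)) * q  ≡⟨ c+2x≡d+[1+2a]q ⟨
      c + (x + x)            ∎

  central-valuation : ∀ x {c} → c ≤ 1 → CentralValuation c x
  central-valuation = <-rec (λ x → ∀ {c} → c ≤ 1 → CentralValuation c x) step
    where
    step : ∀ x → (∀ {y} → y < x → ∀ {c} → c ≤ 1 → CentralValuation c y) →
           ∀ {c} → c ≤ 1 → CentralValuation c x
    step zero      _   z≤n       = 0 , 0 , (1 , refl , ∤1) , (1 , refl , ∤1) , inj₁ refl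
    step zero      _   (s≤s z≤n) = 0 , 0 , (1 , refl , ∤1) , (1 , refl , ∤1) , inj₁ refl
    step x@(suc _) rec {c} c≤1 = subst (CentralValuation c) (sym (m≡m%n+[m/n]*n x q)) by-carry
      where
      x/q<x : x / q < x
      x/q<x = m/n<m x q (prime⇒2≤ q-prime)
      by-carry : CentralValuation c (x % q + x / q * q)
      by-carry with c + (x % q + x % q) <? q
      ... | yes s<q = central-valuation-no-carry {c} {a = x / q} (m%n<n x q) s<q (rec x/q<x z≤n)
      ... | no  s≮q = central-valuation-carry {a = x / q} c≤1 (m%n<n x q) (≮⇒≥ s≮q) (rec x/q<x ≤-refl)

central-binomial-* : ∀ m → ((m + m) C m) * (m ! * m !) ≡ (m + m) !
central-binomial-* m = begin
  ((m + m) C m) * (m ! * m !)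
    ≡⟨ cong (_* (m ! * m !)) (nCk≡n!/k![n-k]! (m≤m+n m m)) ⟩
  (m + m) ! / (m ! * (m + m ∸ m) !) * (m ! * m !)
    ≡⟨ cong (_* (m ! * m !)) (/-congʳ (cong (λ z → m ! * z !) (m+n∸m≡n m m))) ⟩
  (m + m) ! / (m ! * m !) * (m ! * m !)
    ≡⟨ m/n*n≡m (subst (_∣ (m + m) !) (cong (λ z → m ! * z !) (m+n∸m≡n m m)) (k![n∸k]!∣n! (m≤m+n m m))) ⟩
  (m + m) ! ∎
  where
  open ≡-Reasoning
  instance
    _ = m !* (m + m ∸ m) !≢0
    _ = m !* m !≢0

2^m*m!*m!≤[2m]! : ∀ m → 2 ^ m * (m ! * m !) ≤ (m + m) !
2^m*m!*m!≤[2m]! zero    = ≤-refl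
2^m*m!*m!≤[2m]! (suc m) = begin
  2 ^ suc m * (suc m ! * suc m !)
    ≡⟨ shuffle m (2 ^ m) (m !) ⟩
  (suc (suc (m + m)) * suc m) * (2 ^ m * (m ! * m !))
    ≤⟨ *-mono-≤ (*-monoʳ-≤ (suc (suc (m + m))) (s≤s (m≤m+n m m))) (2^m*m!*m!≤[2m]! m) ⟩
  (suc (suc (m + m)) * suc (m + m)) * (m + m) !
    ≡⟨ *-assoc (suc (suc (m + m))) (suc (m + m)) ((m + m) !) ⟩
  suc (suc (m + m)) !
    ≡⟨ cong (λ z → suc z !) (+-suc m m) ⟨
  (suc m + suc m) ! ∎
  where
  open ≤-Reasoning
  shuffle : ∀ m P F → 2 * P * ((suc m * F) * (suc m * F)) ≡ (suc (suc (m + m)) * suc m) * (P * (F * F))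
  shuffle = solve-∀

2^m≤central-binomial : ∀ m → 2 ^ m ≤ (m + m) C m
2^m≤central-binomial m = *-cancelʳ-≤ (2 ^ m) ((m + m) C m) (m ! * m !) {{m !* m !≢0}}
  (subst (2 ^ m * (m ! * m !) ≤_) (sym (central-binomial-* m)) (2^m*m!*m!≤[2m]! m))

prime-power-∣-central-binomial : ∀ {q m} → Prime q → 1 ≤ m → ∀ t → q ^ t ∣ (m + m) C m → q ^ t ≤ m + m
prime-power-∣-central-binomial {q} {m} q-prime 1≤m t q^t∣X
  with central-valuation q-prime m z≤n
... | e , g , (u , m!≡ , _) , (v , [2m]!≡ , q∤v) , g-bound =
  ≤-trans (^-monoʳ-≤ q t≤g) q^g≤2m
  where
  instance
    _ = prime⇒nonZero q-prime
    _ = m*n≢0 (q ^ e) (q ^ e) {{m^n≢0 q e}} {{m^n≢0 q e}}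
  X = (m + m) C m
  shuffleˡ : ∀ X P u → P * P * (X * (u * u)) ≡ X * (P * u * (P * u))
  shuffleˡ = solve-∀
  shuffleʳ : ∀ G P v → G * (P * P) * v ≡ P * P * (G * v)
  shuffleʳ = solve-∀
  X*u*u≡q^g*v : X * (u * u) ≡ q ^ g * v
  X*u*u≡q^g*v = *-cancelˡ-≡ _ _ (q ^ e * q ^ e) (begin
    q ^ e * q ^ e * (X * (u * u))   ≡⟨ shuffleˡ X (q ^ e) u ⟩
    X * (q ^ e * u * (q ^ e * u))   ≡⟨ cong (λ z → X * (z * z)) m!≡ ⟨
    X * (m ! * m !)                 ≡⟨ central-binomial-* m ⟩
    (m + m) !                       ≡⟨ [2m]!≡ ⟩
    q ^ (g + (e + e)) * v           ≡⟨ cong (_* v) (^-distribˡ-+-* q g (e + e)) ⟩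
    q ^ g * q ^ (e + e) * v         ≡⟨ cong (λ z → q ^ g * z * v) (^-distribˡ-+-* q e e) ⟩
    q ^ g * (q ^ e * q ^ e) * v     ≡⟨ shuffleʳ (q ^ g) (q ^ e) v ⟩
    q ^ e * q ^ e * (q ^ g * v)     ∎)
    where open ≡-Reasoning
  t≤g : t ≤ g
  t≤g = ^∣∧^∥⇒≤ q-prime (∣-trans q^t∣X (m∣m*n (u * u))) (v , X*u*u≡q^g*v , q∤v)
  q^g≤2m : q ^ g ≤ m + m
  q^g≤2m = [ (λ { refl → ≤-trans 1≤m (m≤m+n m m) }) , id ]′ g-bound

-- A Chebyshev-type bound on the n-th prime

factor-out : ∀ {q} → Prime q → ∀ X → 1 ≤ X → ∃[ e ] q ^ e ∥ X
factor-out {q} q-prime = <-rec (λ X → 1 ≤ X → ∃[ e ] q ^ e ∥ X) step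
  where
  instance _ = prime⇒nonZero q-prime
  step : ∀ X → (∀ {Y} → Y < X → 1 ≤ Y → ∃[ e ] q ^ e ∥ Y) → 1 ≤ X → ∃[ e ] q ^ e ∥ X
  step X rec 1≤X with q ∣? X
  ... | no  q∤X                 = 0 , X , sym (*-identityˡ X) , q∤X
  ... | yes (divides zero refl) = contradiction 1≤X λ ()
  ... | yes (divides Y@(suc _) refl) with rec (m<m*n Y q (prime⇒2≤ q-prime)) z<s
  ...   | e , u , Y≡q^e*u , q∤u = suc e , u , trans (cong (_* q) Y≡q^e*u) (shuffle (q ^ e) u q) , q∤u
    where
    shuffle : ∀ P u q → P * u * q ≡ q * P * u
    shuffle = solve-∀

bounded-prime-powers⇒≤^length : ∀ {B X} Ps → All Prime Ps → 1 ≤ X →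
  (∀ {r} → Prime r → r ∣ X → r ∈ Ps) →
  (∀ {r} → Prime r → ∀ t → r ^ t ∣ X → r ^ t ≤ B) →
  X ≤ B ^ length Ps
bounded-prime-powers⇒≤^length {B} {X} [] [] 1≤X divisors∈[] _ =
  no-prime-divisor (factorise X {{>-nonZero 1≤X}})
  where
  no-prime-divisor : PrimeFactorisation X → X ≤ 1
  no-prime-divisor record { factors = [] ; isFactorisation = X≡1 } = ≤-reflexive X≡1
  no-prime-divisor record { factors = r ∷ _ ; isFactorisation = refl ; factorsPrime = r-prime ∷ _ }
    with () ← divisors∈[] r-prime (m∣m*n _)
bounded-prime-powers⇒≤^length {B} {X} (q ∷ Ps) (q-prime ∷ Ps-prime) 1≤X divisors∈q∷Ps powers≤B
  with factor-out q-prime X 1≤X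
... | e , Y , refl , q∤Y = *-mono-≤ (powers≤B q-prime e (m∣m*n Y)) Y≤B^|Ps|
  where
  1≤Y : 1 ≤ Y
  1≤Y = n≢0⇒n>0 λ { refl → q∤Y (q ∣0) }
  Y∣X : Y ∣ q ^ e * Y
  Y∣X = n∣m*n (q ^ e)
  divisors∈Ps : ∀ {r} → Prime r → r ∣ Y → r ∈ Ps
  divisors∈Ps r-prime r∣Y with divisors∈q∷Ps r-prime (∣-trans r∣Y Y∣X)
  ... | here refl = contradiction r∣Y q∤Y
  ... | there r∈Ps = r∈Ps
  Y≤B^|Ps| : Y ≤ B ^ length Ps
  Y≤B^|Ps| = bounded-prime-powers⇒≤^length Ps Ps-prime 1≤Y divisors∈Ps
    (λ r-prime t r^t∣Y → powers≤B r-prime t (∣-trans r^t∣Y Y∣X))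

2^m≤[2m]^π[2m] : ∀ m → 1 ≤ m → 2 ^ m ≤ (m + m) ^ primesBelow (suc (m + m))
2^m≤[2m]^π[2m] m 1≤m = ≤-trans (2^m≤central-binomial m)
  (bounded-prime-powers⇒≤^length Ps (all-filter prime? (upTo (suc (m + m))))
    (≤-trans (m^n>0 2 m) (2^m≤central-binomial m)) divisors∈Ps
    (λ r-prime → prime-power-∣-central-binomial r-prime 1≤m))
  where
  Ps = filter prime? (upTo (suc (m + m)))
  divisors∈Ps : ∀ {r} → Prime r → r ∣ (m + m) C m → r ∈ Ps
  divisors∈Ps {r} r-prime r∣X = ∈-filter⁺ prime? (∈-upTo⁺ (s≤s r≤2m)) r-prime
    where
    r≤2m : r ≤ m + m
    r≤2m = subst (_≤ m + m) (*-identityʳ r)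
      (prime-power-∣-central-binomial r-prime 1≤m 1 (subst (_∣ (m + m) C m) (sym (*-identityʳ r)) r∣X))

primesBelow-suc : ∀ a → primesBelow a ≤ primesBelow (suc a)
primesBelow-suc a = begin
  length (filter prime? (upTo a))
    ≤⟨ m≤m+n _ _ ⟩
  length (filter prime? (upTo a)) + length (filter prime? [ a ])
    ≡⟨ length-++ (filter prime? (upTo a)) ⟨
  length (filter prime? (upTo a) ++ filter prime? [ a ])
    ≡⟨ cong length (filter-++ prime? (upTo a) [ a ]) ⟨
  length (filter prime? (upTo a ++ [ a ]))
    ≡⟨ cong (λ xs → length (filter prime? xs)) (upTo-∷ʳ a) ⟩
  primesBelow (suc a) ∎
  where open ≤-Reasoning

primesBelow-mono : ∀ {a b} → a ≤ b → primesBelow a ≤ primesBelow b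
primesBelow-mono = mono ∘ ≤⇒≤′
  where
  mono : ∀ {a b} → a ≤′ b → primesBelow a ≤ primesBelow b
  mono ≤′-refl         = ≤-refl
  mono {b = suc b} (≤′-step a≤′b) = ≤-trans (mono a≤′b) (primesBelow-suc b)

n<2^n : ∀ n → n < 2 ^ n
n<2^n zero    = z<s
n<2^n (suc n) = +-mono-≤ (m^n>0 2 n) (≤-trans (n<2^n n) (m≤m+n (2 ^ n) 0))

nth-prime-≤ : ∀ {p} → IsPrimeEnum p → ∀ {j} l → 1 ≤ j → j < 2 ^ l → p j ≤ 12 * (l * j)
nth-prime-≤ _ zero (s≤s z≤n) (s≤s ())
nth-prime-≤ {p} p-enum {j} l@(suc l-1) 1≤j@(s≤s z≤n) j<2^l = subst (p j ≤_) (2m≡12lj l j) p[j]≤2m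
  where
  -- With m = 6lj we have 2m ≤ 2 ^ K, so 2 ^ m ≤ (2m) ^ π ≤ 2 ^ (K π) and K ≤ 6l
  -- force j ≤ π = π(2m): there are at least j primes up to 2m, so p j ≤ 2m.
  m K π : ℕ
  m = 6 * (l * j)
  K = 4 + (l + l)
  π = primesBelow (suc (m + m))
  2m≡12lj : ∀ l j → 6 * (l * j) + 6 * (l * j) ≡ 12 * (l * j)
  2m≡12lj = solve-∀
  2m≤2^K : m + m ≤ 2 ^ K
  2m≤2^K = begin
    m + m                ≡⟨ 2m≡12lj l j ⟩
    12 * (l * j)         ≤⟨ *-monoʳ-≤ 12 (*-mono-≤ (<⇒≤ (n<2^n l)) (<⇒≤ j<2^l)) ⟩
    12 * (2 ^ l * 2 ^ l) ≤⟨ *-monoˡ-≤ (2 ^ l * 2 ^ l) (m≤m+n 12 4) ⟩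
    2 ^ 4 * (2 ^ l * 2 ^ l) ≡⟨ cong (2 ^ 4 *_) (^-distribˡ-+-* 2 l l) ⟨
    2 ^ 4 * 2 ^ (l + l)  ≡⟨ ^-distribˡ-+-* 2 4 (l + l) ⟨
    2 ^ K                ∎
    where open ≤-Reasoning
  m≤Kπ : m ≤ K * π
  m≤Kπ = ≮⇒≥ λ Kπ<m → <⇒≱ (^-monoʳ-< 2 (s≤s (s≤s z≤n)) Kπ<m) (begin
    2 ^ m            ≤⟨ 2^m≤[2m]^π[2m] m (s≤s z≤n) ⟩
    (m + m) ^ π      ≤⟨ ^-monoˡ-≤ π 2m≤2^K ⟩
    (2 ^ K) ^ π      ≡⟨ ^-*-assoc 2 K π ⟩
    2 ^ (K * π)      ∎)
    where open ≤-Reasoning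
  j≤π : j ≤ π
  j≤π = *-cancelˡ-≤ (6 * l) (begin
    6 * l * j   ≡⟨ *-assoc 6 l j ⟩
    m           ≤⟨ m≤Kπ ⟩
    K * π       ≤⟨ *-monoˡ-≤ π K≤6l ⟩
    6 * l * π   ∎)
    where
    open ≤-Reasoning
    6l≡K+4[l-1] : ∀ k → 6 * suc k ≡ (4 + (suc k + suc k)) + 4 * k
    6l≡K+4[l-1] = solve-∀
    K≤6l : K ≤ 6 * l
    K≤6l = subst (K ≤_) (sym (6l≡K+4[l-1] l-1)) (m≤m+n K _)
  p[j]≤2m : p j ≤ m + m
  p[j]≤2m = ≮⇒≥ λ 2m<p[j] → <⇒≱ (n<1+n _) (begin
    j                      ≤⟨ j≤π ⟩
    π                      ≤⟨ primesBelow-mono 2m<p[j] ⟩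
    primesBelow (p j)      ≡⟨ proj₂ (p-enum j 1≤j) ⟩
    j ∸ 1                  ∎)
    where open ≤-Reasoning

2≤nth-prime : ∀ {p} → IsPrimeEnum p → ∀ {j} → 1 ≤ j → 2 ≤ p j
2≤nth-prime p-enum {j} 1≤j = prime⇒2≤ (proj₁ (p-enum j 1≤j))

⌊log₂⌋-bounds : ∀ N → 2 ≤ N → 1 ≤ ⌊log₂ N ⌋ × N < 2 ^ suc ⌊log₂ N ⌋
⌊log₂⌋-bounds N 2≤N =
  subst (_≤ ⌊log₂ N ⌋) (⌊log₂[2^n]⌋≡n 1) (⌊log₂⌋-mono-≤ 2≤N) ,
  ≰⇒> λ 2^[1+L]≤N → <⇒≱ (n<1+n ⌊log₂ N ⌋)
    (subst (_≤ ⌊log₂ N ⌋) (⌊log₂[2^n]⌋≡n (suc ⌊log₂ N ⌋)) (⌊log₂⌋-mono-≤ 2^[1+L]≤N))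

window-prime-≤ : ∀ {p} → IsPrimeEnum p → ∀ {n k i} → 1 ≤ n → 1 ≤ k → i < k →
                 p (n + i) ≤ 24 * ((n + k) * ⌊log₂ (n + k) ⌋)
window-prime-≤ {p} p-enum {n} {k} {i} 1≤n 1≤k i<k = begin
  p (n + i)                 ≤⟨ nth-prime-≤ p-enum (suc L) (≤-trans 1≤n (m≤m+n n i)) (<-trans j<N N<2^[1+L]) ⟩
  12 * (suc L * (n + i))    ≤⟨ *-monoʳ-≤ 12 (*-mono-≤ (+-monoˡ-≤ L 1≤L) (<⇒≤ j<N)) ⟩
  12 * ((L + L) * N)        ≡⟨ regroup L N ⟩
  24 * (N * L)              ∎
  where
  open ≤-Reasoning
  N = n + k
  L = ⌊log₂ N ⌋
  1≤L = proj₁ (⌊log₂⌋-bounds N (+-mono-≤ 1≤n 1≤k))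
  N<2^[1+L] = proj₂ (⌊log₂⌋-bounds N (+-mono-≤ 1≤n 1≤k))
  j<N : n + i < N
  j<N = +-monoʳ-< n i<k
  regroup : ∀ L N → 12 * ((L + L) * N) ≡ 24 * (N * L)
  regroup = solve-∀

fromℕ : ℕ → ℚ
fromℕ n = n · 1ℚ

fromℕ-nonneg : ∀ n → 0ℚ ℚ.≤ fromℕ n
fromℕ-nonneg zero    = ℚP.≤-refl
fromℕ-nonneg (suc n) = ℚP.+-mono-≤ (ℚP.<⇒≤ (ℚP.positive⁻¹ 1ℚ)) (fromℕ-nonneg n)

fromℕ-mono-≤ : ∀ {m n} → m ≤ n → fromℕ m ℚ.≤ fromℕ n
fromℕ-mono-≤ {n = n} z≤n = fromℕ-nonneg n
fromℕ-mono-≤ (s≤s m≤n)   = ℚP.+-monoʳ-≤ 1ℚ (fromℕ-mono-≤ m≤n)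

fromℕ-suc-positive : ∀ n → ℚ.Positive (fromℕ (suc n))
fromℕ-suc-positive n = ℚP.pos+nonNeg⇒pos 1ℚ (fromℕ n) {{ℚ.nonNegative (fromℕ-nonneg n)}}

1/[1+_] : ℕ → ℚ
1/[1+ k ] = (1/ fromℕ (suc k)) {{ℚP.pos⇒nonZero (fromℕ (suc k)) {{fromℕ-suc-positive k}}}}

1/[1+k]-nonneg : ∀ k → 0ℚ ℚ.≤ 1/[1+ k ]
1/[1+k]-nonneg k = ℚP.<⇒≤ (ℚP.positive⁻¹ 1/[1+ k ] {{ℚP.1/pos⇒pos (fromℕ (suc k)) {{fromℕ-suc-positive k}}}})

fromℕ[1+k]*1/[1+k] : ∀ k → fromℕ (suc k) ℚ.* 1/[1+ k ] ≡ 1ℚ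
fromℕ[1+k]*1/[1+k] k = ℚP.*-inverseʳ (fromℕ (suc k)) {{ℚP.pos⇒nonZero (fromℕ (suc k)) {{fromℕ-suc-positive k}}}}

fromℕ[c]*1/[1+k]≤1/3 : ∀ {k} c → 3 * c ≤ suc k → fromℕ c ℚ.* 1/[1+ k ] ℚ.≤ ℤ.+ 1 ℚ./ 3
fromℕ[c]*1/[1+k]≤1/3 {k} c 3c≤1+k = begin
  fromℕ c ℚ.* u
    ≡⟨ ℚP.*-identityˡ (fromℕ c ℚ.* u) ⟨
  (⅓ ℚ.* fromℕ 3) ℚ.* (fromℕ c ℚ.* u)
    ≡⟨ ℚP.*-assoc ⅓ (fromℕ 3) (fromℕ c ℚ.* u) ⟩
  ⅓ ℚ.* (fromℕ 3 ℚ.* (fromℕ c ℚ.* u))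
    ≡⟨ cong (⅓ ℚ.*_) (ℚP.*-assoc (fromℕ 3) (fromℕ c) u) ⟨
  ⅓ ℚ.* (fromℕ 3 ℚ.* fromℕ c ℚ.* u)
    ≡⟨ cong (λ z → ⅓ ℚ.* (z ℚ.* u)) (×1-homo-* 3 c) ⟨
  ⅓ ℚ.* (fromℕ (3 * c) ℚ.* u)
    ≤⟨ ℚP.*-monoˡ-≤-nonNeg ⅓ (ℚP.*-monoʳ-≤-nonNeg u {{u≥0}} (fromℕ-mono-≤ 3c≤1+k)) ⟩
  ⅓ ℚ.* (fromℕ (suc k) ℚ.* u)
    ≡⟨ cong (⅓ ℚ.*_) (fromℕ[1+k]*1/[1+k] k) ⟩
  ⅓ ℚ.* 1ℚ
    ≡⟨ ℚP.*-identityʳ ⅓ ⟩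
  ⅓ ∎
  where
  -- the first step holds because ⅓ ℚ.* fromℕ 3 normalises to 1ℚ
  open ℚP.≤-Reasoning
  ⅓ u : ℚ
  ⅓ = ℤ.+ 1 ℚ./ 3
  u = 1/[1+ k ]
  u≥0 : ℚ.NonNegative u
  u≥0 = ℚ.nonNegative (1/[1+k]-nonneg k)

indicator : Bool → ℚ
indicator b = if b then 1ℚ else 0ℚ

indicator-nonneg : ∀ b → 0ℚ ℚ.≤ indicator b
indicator-nonneg true  = ℚP.<⇒≤ (ℚP.positive⁻¹ 1ℚ)
indicator-nonneg false = ℚP.≤-refl

δ : ∀ {s} → Fin s → Fin s → ℚ
δ i j = indicator (does (i Fin.≟ j))

sumFin≡sum : ∀ s (f : Fin s → ℚ) → sumFin s f ≡ sum f
sumFin≡sum zero    f = refl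
sumFin≡sum (suc s) f = cong (f zero ℚ.+_) (sumFin≡sum s (f ∘ suc))

∑-const : ∀ n x → ∑[ i < n ] x ≡ fromℕ n ℚ.* x
∑-const n x = trans (sum-replicate n) (sym (trans (×-assoc-* n 1ℚ x) (cong (n ·_) (ℚP.*-identityˡ x))))

∑-δ : ∀ {s} (x : Fin s) (h : Fin s → ℚ) → ∑[ i < s ] (δ i x ℚ.* h i) ≡ h x
∑-δ {suc s} zero h = begin
  1ℚ ℚ.* h zero ℚ.+ ∑[ i < s ] (0ℚ ℚ.* h (suc i))
    ≡⟨ cong₂ ℚ._+_ (ℚP.*-identityˡ (h zero)) (sum-cong-≗ (ℚP.*-zeroˡ ∘ h ∘ suc)) ⟩
  h zero ℚ.+ ∑[ i < s ] 0ℚ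
    ≡⟨ cong (h zero ℚ.+_) (trans (∑-const s 0ℚ) (ℚP.*-zeroʳ (fromℕ s))) ⟩
  h zero ℚ.+ 0ℚ
    ≡⟨ ℚP.+-identityʳ (h zero) ⟩
  h zero ∎
  where open ≡-Reasoning
∑-δ {suc s} (suc x) h =
  trans (cong₂ ℚ._+_ (ℚP.*-zeroˡ (h zero)) (∑-δ x (h ∘ suc))) (ℚP.+-identityˡ (h (suc x)))

∑-↑ : ∀ m n (f : Fin (m + n) → ℚ) → sum f ≡ ∑[ i < m ] f (i ↑ˡ n) ℚ.+ ∑[ j < n ] f (m ↑ʳ j)
∑-↑ zero    n f = sym (ℚP.+-identityˡ (sum f))
∑-↑ (suc m) n f = trans (cong (f zero ℚ.+_) (∑-↑ m n (f ∘ suc)))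
  (sym (ℚP.+-assoc (f zero) (∑[ i < m ] f (suc i ↑ˡ n)) (∑[ j < n ] f (suc m ↑ʳ j))))

∑-combine : ∀ m n (f : Fin (m * n) → ℚ) → sum f ≡ ∑[ i < m ] ∑[ j < n ] f (combine i j)
∑-combine zero    n f = refl
∑-combine (suc m) n f =
  trans (∑-↑ n (m * n) f) (cong (∑[ j < n ] f (j ↑ˡ (m * n)) ℚ.+_) (∑-combine m n (f ∘ (n ↑ʳ_))))

-- Deterministic automata as PFAs

module Deterministic {s : ℕ} (next : Fin s → Fin s) (v₀ : Fin s → ℚ) (accepting : Fin s → Bool)
                     (v₀-nonneg : ∀ i → 0ℚ ℚ.≤ v₀ i) (v₀-sum : sumFin s v₀ ≡ 1ℚ) where

  automaton : PFA
  automaton = record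
    { states       = s
    ; trans        = λ i j → δ i (next j)
    ; init         = v₀
    ; accept       = accepting
    ; trans-nonneg = λ i j → indicator-nonneg (does (i Fin.≟ next j))
    ; trans-col    = λ j → begin
        sumFin s (λ i → δ i (next j))           ≡⟨ sumFin≡sum s _ ⟩
        ∑[ i < s ] δ i (next j)                 ≡⟨ sum-cong-≗ (λ i → ℚP.*-identityʳ (δ i (next j))) ⟨
        ∑[ i < s ] (δ i (next j) ℚ.* 1ℚ)        ≡⟨ ∑-δ (next j) (λ _ → 1ℚ) ⟩
        1ℚ                                      ∎
    ; init-nonneg  = v₀-nonneg
    ; init-sum     = v₀-sum
    }
    where open ≡-Reasoning

  -- The transition matrix is the transpose of precomposition with next.
  pairing-vec : ∀ m (h : Fin s → ℚ) →
    ∑[ i < s ] (h i ℚ.* vec automaton m i) ≡ ∑[ j < s ] (v₀ j ℚ.* h (fold j next m))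
  pairing-vec zero    h = sum-cong-≗ (λ i → ℚP.*-comm (h i) (v₀ i))
  pairing-vec (suc m) h = begin
    ∑[ i < s ] (h i ℚ.* sumFin s (λ j → δ i (next j) ℚ.* v j))
      ≡⟨ sum-cong-≗ (λ i → cong (h i ℚ.*_) (sumFin≡sum s _)) ⟩
    ∑[ i < s ] (h i ℚ.* ∑[ j < s ] (δ i (next j) ℚ.* v j))
      ≡⟨ sum-cong-≗ (λ i → *-distribˡ-sum (h i) (λ j → δ i (next j) ℚ.* v j)) ⟩
    ∑[ i < s ] ∑[ j < s ] (h i ℚ.* (δ i (next j) ℚ.* v j))
      ≡⟨ ∑-comm (λ i j → h i ℚ.* (δ i (next j) ℚ.* v j)) ⟩
    ∑[ j < s ] ∑[ i < s ] (h i ℚ.* (δ i (next j) ℚ.* v j))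
      ≡⟨ sum-cong-≗ (λ j → sum-cong-≗ (λ i → regroup (h i) (δ i (next j)) (v j))) ⟩
    ∑[ j < s ] ∑[ i < s ] (δ i (next j) ℚ.* h i ℚ.* v j)
      ≡⟨ sum-cong-≗ (λ j → *-distribʳ-sum (v j) (λ i → δ i (next j) ℚ.* h i)) ⟨
    ∑[ j < s ] (∑[ i < s ] (δ i (next j) ℚ.* h i) ℚ.* v j)
      ≡⟨ sum-cong-≗ (λ j → cong (ℚ._* v j) (∑-δ (next j) h)) ⟩
    ∑[ j < s ] (h (next j) ℚ.* v j)
      ≡⟨ pairing-vec m (h ∘ next) ⟩
    ∑[ j < s ] (v₀ j ℚ.* h (next (fold j next m))) ∎
    where
    open ≡-Reasoning
    v = vec automaton m
    regroup : ∀ a b c → a ℚ.* (b ℚ.* c) ≡ b ℚ.* a ℚ.* c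
    regroup a b c = trans (sym (ℚP.*-assoc a b c)) (cong (ℚ._* c) (ℚP.*-comm a b))

  accProb-fold : ∀ m → accProb automaton m ≡ ∑[ j < s ] (v₀ j ℚ.* indicator (accepting (fold j next m)))
  accProb-fold m = begin
    accProb automaton m
      ≡⟨ sumFin≡sum s _ ⟩
    ∑[ i < s ] (if accepting i then vec automaton m i else 0ℚ)
      ≡⟨ sum-cong-≗ (λ i → select (accepting i) (vec automaton m i)) ⟩
    ∑[ i < s ] (indicator (accepting i) ℚ.* vec automaton m i)
      ≡⟨ pairing-vec m (indicator ∘ accepting) ⟩
    ∑[ j < s ] (v₀ j ℚ.* indicator (accepting (fold j next m))) ∎
    where
    open ≡-Reasoning
    select : ∀ b x → (if b then x else 0ℚ) ≡ indicator b ℚ.* x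
    select true  x = sym (ℚP.*-identityˡ x)
    select false x = sym (ℚP.*-zeroˡ x)

[1+m]%n≡[1+m%n]%n : ∀ m n .{{_ : NonZero n}} → suc m % n ≡ suc (m % n) % n
[1+m]%n≡[1+m%n]%n m n = begin
  (1 + m) % n               ≡⟨ %-distribˡ-+ 1 m n ⟩
  (1 % n + m % n) % n       ≡⟨ cong (λ z → (1 % n + z) % n) (m%n%n≡m%n m n) ⟨
  (1 % n + m % n % n) % n   ≡⟨ %-distribˡ-+ 1 (m % n) n ⟨
  (1 + m % n) % n           ∎
  where open ≡-Reasoning

cycle : ∀ {b} q .{{_ : NonZero q}} → q ≤ suc b → Fin (suc b) → Fin (suc b)
cycle q q≤1+b r = fromℕ< (≤-trans (m%n<n (suc (toℕ r)) q) q≤1+b)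

toℕ-fold-cycle : ∀ {b} q .{{_ : NonZero q}} (q≤1+b : q ≤ suc b) m →
  toℕ (fold zero (cycle q q≤1+b) m) ≡ m % q
toℕ-fold-cycle q q≤1+b zero    = sym (m<n⇒m%n≡m (>-nonZero⁻¹ q))
toℕ-fold-cycle q q≤1+b (suc m) = begin
  toℕ (cycle q q≤1+b (fold zero (cycle q q≤1+b) m))   ≡⟨ toℕ-fromℕ< _ ⟩
  suc (toℕ (fold zero (cycle q q≤1+b) m)) % q         ≡⟨ cong (λ z → suc z % q) (toℕ-fold-cycle q q≤1+b m) ⟩
  suc (m % q) % q                                    ≡⟨ [1+m]%n≡[1+m%n]%n m q ⟨
  suc m % q                                          ∎
  where open ≡-Reasoning

fold-cycle-at-zero : ∀ {b} q .{{_ : NonZero q}} (q≤1+b : q ≤ suc b) m →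
  does (fold zero (cycle q q≤1+b) m Fin.≟ zero) ≡ does (q ∣? m)
fold-cycle-at-zero q q≤1+b m with fold zero (cycle q q≤1+b) m | toℕ-fold-cycle q q≤1+b m
... | zero  | 0≡m%q   = sym (dec-true (q ∣? m) (m%n≡0⇒n∣m m q (sym 0≡m%q)))
... | suc _ | 1+r≡m%q =
  sym (dec-false (q ∣? m) (λ q∣m → 0≢1+n (trans (sym (n∣m⇒m%n≡0 m q q∣m)) (sym 1+r≡m%q))))

module CyclicBlocks {k b : ℕ} (q : Fin (suc k) → ℕ) (q≥1 : ∀ i → 1 ≤ q i) (q≤1+b : ∀ i → q i ≤ suc b) where

  step : Fin (suc k) → Fin (suc b) → Fin (suc b)
  step i = cycle (q i) {{>-nonZero (q≥1 i)}} (q≤1+b i)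

  -- State combine i r is position r of block i; the block is a cycle on its
  -- first q i positions, and the remaining positions are unreachable padding.
  block : Fin (suc k * suc b) → Fin (suc k) × Fin (suc b)
  block = remQuot {suc k} (suc b)

  next : Fin (suc k * suc b) → Fin (suc k * suc b)
  next x = combine (proj₁ (block x)) (step (proj₁ (block x)) (proj₂ (block x)))

  v₀ : Fin (suc k * suc b) → ℚ
  v₀ x = δ (proj₂ (block x)) zero ℚ.* 1/[1+ k ]

  accepting : Fin (suc k * suc b) → Bool
  accepting x = does (proj₂ (block x) Fin.≟ zero)

  fold-next-combine : ∀ i r m → fold (combine i r) next m ≡ combine i (fold r (step i) m)
  fold-next-combine i r zero    = refl
  fold-next-combine i r (suc m) = begin
    next (fold (combine i r) next m)
      ≡⟨ cong next (fold-next-combine i r m) ⟩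
    next (combine i (fold r (step i) m))
      ≡⟨ cong (λ (j , s) → combine j (step j s)) (remQuot-combine {suc k} {suc b} i _) ⟩
    combine i (step i (fold r (step i) m)) ∎
    where open ≡-Reasoning

  v₀-sum : sumFin (suc k * suc b) v₀ ≡ 1ℚ
  v₀-sum = begin
    sumFin (suc k * suc b) v₀
      ≡⟨ sumFin≡sum (suc k * suc b) v₀ ⟩
    sum v₀
      ≡⟨ ∑-combine (suc k) (suc b) v₀ ⟩
    ∑[ i < suc k ] ∑[ r < suc b ] v₀ (combine i r)
      ≡⟨ sum-cong-≗ (λ i → sum-cong-≗ (λ r → cong (λ (_ , s) → δ s zero ℚ.* u) (remQuot-combine {suc k} {suc b} i r))) ⟩
    ∑[ i < suc k ] ∑[ r < suc b ] (δ r zero ℚ.* u)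
      ≡⟨ sum-cong-≗ {suc k} (λ _ → ∑-δ {suc b} zero (λ _ → u)) ⟩
    ∑[ i < suc k ] u
      ≡⟨ ∑-const (suc k) u ⟩
    fromℕ (suc k) ℚ.* u
      ≡⟨ fromℕ[1+k]*1/[1+k] k ⟩
    1ℚ ∎
    where
    open ≡-Reasoning
    u = 1/[1+ k ]

  v₀-nonneg : ∀ x → 0ℚ ℚ.≤ v₀ x
  v₀-nonneg x = ℚP.nonNegative⁻¹ (v₀ x) {{ℚP.nonNeg*nonNeg⇒nonNeg
    (δ (proj₂ (block x)) zero) {{ℚ.nonNegative (indicator-nonneg (does (proj₂ (block x) Fin.≟ zero)))}}
    1/[1+ k ] {{ℚ.nonNegative (1/[1+k]-nonneg k)}}}}

  open Deterministic next v₀ accepting v₀-nonneg v₀-sum public using (automaton; accProb-fold)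

  accProb-blocks : ∀ m → accProb automaton m ≡ ∑[ i < suc k ] indicator (does (q i ∣? m)) ℚ.* 1/[1+ k ]
  accProb-blocks m = begin
    accProb automaton m
      ≡⟨ accProb-fold m ⟩
    ∑[ x < suc k * suc b ] (v₀ x ℚ.* indicator (accepting (fold x next m)))
      ≡⟨ ∑-combine (suc k) (suc b) (λ x → v₀ x ℚ.* indicator (accepting (fold x next m))) ⟩
    ∑[ i < suc k ] ∑[ r < suc b ]
      (v₀ (combine i r) ℚ.* indicator (accepting (fold (combine i r) next m)))
        ≡⟨ sum-cong-≗ (λ i → sum-cong-≗ (on-block i)) ⟩
    ∑[ i < suc k ] ∑[ r < suc b ] (δ r zero ℚ.* (at-zero i r ℚ.* u))
      ≡⟨ sum-cong-≗ (λ i → ∑-δ zero (λ r → at-zero i r ℚ.* u)) ⟩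
    ∑[ i < suc k ] (at-zero i zero ℚ.* u)
      ≡⟨ sum-cong-≗ (λ i → cong (λ z → indicator z ℚ.* u) (fold-cycle-at-zero (q i) {{>-nonZero (q≥1 i)}} (q≤1+b i) m)) ⟩
    ∑[ i < suc k ] (indicator (does (q i ∣? m)) ℚ.* u)
      ≡⟨ *-distribʳ-sum u (λ i → indicator (does (q i ∣? m))) ⟨
    ∑[ i < suc k ] indicator (does (q i ∣? m)) ℚ.* u ∎
    where
    open ≡-Reasoning
    u = 1/[1+ k ]
    at-zero : Fin (suc k) → Fin (suc b) → ℚ
    at-zero i r = indicator (does (fold r (step i) m Fin.≟ zero))
    on-block : ∀ i r → v₀ (combine i r) ℚ.* indicator (accepting (fold (combine i r) next m))
                       ≡ δ r zero ℚ.* (at-zero i r ℚ.* u)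
    on-block i r = begin
      v₀ (combine i r) ℚ.* indicator (accepting (fold (combine i r) next m))
        ≡⟨ cong₂ (λ (_ , s) (_ , t) → δ s zero ℚ.* u ℚ.* indicator (does (t Fin.≟ zero)))
                 (remQuot-combine {suc k} {suc b} i r)
                 (trans (cong block (fold-next-combine i r m)) (remQuot-combine {suc k} {suc b} i _)) ⟩
      δ r zero ℚ.* u ℚ.* at-zero i r      ≡⟨ ℚP.*-assoc (δ r zero) u (at-zero i r) ⟩
      δ r zero ℚ.* (u ℚ.* at-zero i r)    ≡⟨ cong (δ r zero ℚ.*_) (ℚP.*-comm u (at-zero i r)) ⟩
      δ r zero ℚ.* (at-zero i r ℚ.* u)    ∎

-- The automaton for L^{k,n}

count : (ℕ → Bool) → ℕ → ℕ
count g zero    = 0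
count g (suc k) = (if g 0 then 1 else 0) + count (g ∘ suc) k

count-cong : ∀ {g h} k → (∀ i → g i ≡ h i) → count g k ≡ count h k
count-cong zero    g≗h = refl
count-cong (suc k) g≗h = cong₂ (λ b c → (if b then 1 else 0) + c) (g≗h 0) (count-cong k (g≗h ∘ suc))

count-all : ∀ g k → (∀ i → i < k → g i ≡ true) → count g k ≡ k
count-all g zero    _   = refl
count-all g (suc k) all rewrite all 0 z<s = cong suc (count-all (g ∘ suc) k (λ i i<k → all (suc i) (s<s i<k)))

count+count-not : ∀ g k → count g k + count (not ∘ g) k ≡ k
count+count-not g zero    = refl
count+count-not g (suc k) with g 0 | count+count-not (g ∘ suc) k
... | true  | eq = cong suc eq
... | false | eq = trans (+-suc _ _) (cong suc eq)

without : (ℕ → Bool) → ℕ → ℕ → Bool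
without g a i = g i ∧ not (does (i ≟ a))

count-without : ∀ g {k} a → a < k → g a ≡ true → count g k ≡ suc (count (without g a) k)
count-without g {suc k} zero    _         g0≡true rewrite g0≡true =
  cong suc (count-cong k (λ i → sym (∧-identityʳ (g (suc i)))))
count-without g {suc k} (suc a) (s<s a<k) ga≡true with g 0 | count-without (g ∘ suc) a a<k ga≡true
... | true  | eq = cong suc eq
... | false | eq = eq

unique-≤-count : ∀ {n k} g {S} → Unique S → All (λ j → n ≤ j × j < n + k × g (j ∸ n) ≡ true) S →
                 length S ≤ count g k
unique-≤-count g {[]}    _                   _ = z≤n
unique-≤-count {n} {k} g {x ∷ S} (x∉S ∷ S-unique) ((n≤x , x<n+k , gx) ∷ S-valid) =
  subst (suc (length S) ≤_) (sym (count-without g (x ∸ n) x∸n<k gx))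
    (s≤s (unique-≤-count (without g (x ∸ n)) S-unique (All.zipWith still-valid (x∉S , S-valid))))
  where
  x∸n<k : x ∸ n < k
  x∸n<k = +-cancelˡ-< n (x ∸ n) k (subst (_< n + k) (sym (m+[n∸m]≡n n≤x)) x<n+k)
  still-valid : ∀ {y} → x ≢ y × (n ≤ y × y < n + k × g (y ∸ n) ≡ true) →
                n ≤ y × y < n + k × without g (x ∸ n) (y ∸ n) ≡ true
  still-valid {y} (x≢y , n≤y , y<n+k , gy) =
    n≤y , y<n+k , cong₂ (λ b c → b ∧ not c) gy
      (dec-false (y ∸ n ≟ x ∸ n) (λ eq → x≢y (sym (∸-cancelʳ-≡ n≤y n≤x eq))))

∑-indicator≡count : ∀ k (g : ℕ → Bool) → ∑[ i < k ] indicator (g (toℕ i)) ≡ fromℕ (count g k)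
∑-indicator≡count zero    g = refl
∑-indicator≡count (suc k) g with g 0 | ∑-indicator≡count k (g ∘ suc)
... | true  | eq = cong (1ℚ ℚ.+_) eq
... | false | eq = trans (ℚP.+-identityˡ _) eq

in-band⇒∤ : ∀ {q m} → 1 ≤ q → InBand q m → ¬ q ∣ m
in-band⇒∤ {q} 1≤q (t , r , refl , r<q , band) q∣m =
  <⇒≱ r<q (∣⇒≤ {{r≢0}} (∣m+n∣m⇒∣n q∣m (n∣m*n t)))
  where
  q≤8r : q ≤ 8 * r
  q≤8r = [ proj₁ , (λ (5q≤8r , _) → ≤-trans (m≤n*m q 5) 5q≤8r) ]′ band
  r≢0 : NonZero r
  r≢0 = ≢-nonZero λ { refl → <⇒≱ 1≤q (≤-trans q≤8r (≤-reflexive (*-zeroʳ 8))) }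

∣-primeProd : ∀ p n {k i} → i < k → p (n + i) ∣ primeProd p n k
∣-primeProd p n {suc k} {zero}  _         = subst (λ j → p j ∣ primeProd p n (suc k)) (sym (+-identityʳ n)) (m∣m*n _)
∣-primeProd p n {suc k} {suc i} (s<s i<k) =
  subst (λ j → p j ∣ primeProd p n (suc k)) (sym (+-suc n i)) (∣n⇒∣m*n (p n) (∣-primeProd p (suc n) i<k))

module WindowAutomaton (p : ℕ → ℕ) (p-enum : IsPrimeEnum p) (n : ℕ) (1≤n : 1 ≤ n) {k b : ℕ}
                       (p≤1+b : ∀ i → i < suc k → p (n + i) ≤ suc b) where

  1≤p : ∀ {j} → n ≤ j → 1 ≤ p j
  1≤p n≤j = ≤-trans (s≤s z≤n) (2≤nth-prime p-enum (≤-trans 1≤n n≤j))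

  module Blocks = CyclicBlocks {k} {b} (λ i → p (n + toℕ i)) (λ i → 1≤p (m≤m+n n (toℕ i)))
                                        (λ i → p≤1+b (toℕ i) (Fin.toℕ<n i))
  open Blocks public using (automaton)

  divides-at : ℕ → ℕ → Bool
  divides-at m i = does (p (n + i) ∣? m)

  accProb-count : ∀ m → accProb automaton m ≡ fromℕ (count (divides-at m) (suc k)) ℚ.* 1/[1+ k ]
  accProb-count m =
    trans (Blocks.accProb-blocks m) (cong (ℚ._* 1/[1+ k ]) (∑-indicator≡count (suc k) (divides-at m)))

  accepts-yes : ∀ m → LYes p n (suc k) m → accProb automaton m ≡ 1ℚ
  accepts-yes m N∣m = begin
    accProb automaton m
      ≡⟨ accProb-count m ⟩
    fromℕ (count (divides-at m) (suc k)) ℚ.* 1/[1+ k ]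
      ≡⟨ cong (λ c → fromℕ c ℚ.* 1/[1+ k ]) (count-all (divides-at m) (suc k) all-divide) ⟩
    fromℕ (suc k) ℚ.* 1/[1+ k ]
      ≡⟨ fromℕ[1+k]*1/[1+k] k ⟩
    1ℚ ∎
    where
    open ≡-Reasoning
    all-divide : ∀ i → i < suc k → divides-at m i ≡ true
    all-divide i i<k = dec-true (p (n + i) ∣? m) (∣-trans (∣-primeProd p n i<k) N∣m)

  rejects-no : ∀ m → LNo p n (suc k) m → accProb automaton m ℚ.≤ ℤ.+ 1 ℚ./ 3
  rejects-no m (S , S-unique , S-in-band , 2k≤3|S|) =
    subst (ℚ._≤ ℤ.+ 1 ℚ./ 3) (sym (accProb-count m)) (fromℕ[c]*1/[1+k]≤1/3 c 3c≤k)
    where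
    c c′ : ℕ
    c  = count (divides-at m) (suc k)
    c′ = count (not ∘ divides-at m) (suc k)
    in-band⇒not-divides : ∀ {j} → n ≤ j × j < n + suc k × InBand (p j) m →
                          n ≤ j × j < n + suc k × not (divides-at m (j ∸ n)) ≡ true
    in-band⇒not-divides {j} (n≤j , j<n+k , band) = n≤j , j<n+k ,
      cong (λ b → not b) (trans (cong (λ i → does (p i ∣? m)) (m+[n∸m]≡n n≤j))
                                (dec-false (p j ∣? m) (in-band⇒∤ (1≤p n≤j) band)))
    |S|≤c′ : length S ≤ c′
    |S|≤c′ = unique-≤-count (not ∘ divides-at m) S-unique (All.map in-band⇒not-divides S-in-band)
    regroup : ∀ a b → 3 * a + 3 * b ≡ 3 * (b + a)
    regroup = solve-∀
    3k≡2k+k : ∀ k → 3 * k ≡ 2 * k + k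
    3k≡2k+k = solve-∀
    3c≤k : 3 * c ≤ suc k
    3c≤k = +-cancelˡ-≤ (2 * suc k) (3 * c) (suc k) (begin
      2 * suc k + 3 * c     ≤⟨ +-monoˡ-≤ (3 * c) (≤-trans 2k≤3|S| (*-monoʳ-≤ 3 |S|≤c′)) ⟩
      3 * c′ + 3 * c        ≡⟨ regroup c′ c ⟩
      3 * (c + c′)          ≡⟨ cong (3 *_) (count+count-not (divides-at m) (suc k)) ⟩
      3 * suc k             ≡⟨ 3k≡2k+k (suc k) ⟩
      2 * suc k + suc k     ∎)
      where open ≤-Reasoning

theorem8 : ∃ λ (C : ℕ) → ∀ (p : ℕ → ℕ) → IsPrimeEnum p →
    ∀ (n k : ℕ) → 1 ≤ n → 1 ≤ k →
    ∃ λ (M : PFA) → states M ≤ C * (k * (n + k) * ⌊log₂ (n + k) ⌋) ×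
      SolvesOneSided M (LYes p n k) (LNo p n k)
theorem8 = 24 , construction
  where
  construction : ∀ p → IsPrimeEnum p → ∀ n k → 1 ≤ n → 1 ≤ k →
    ∃ λ (M : PFA) → states M ≤ 24 * (k * (n + k) * ⌊log₂ (n + k) ⌋) ×
      SolvesOneSided M (LYes p n k) (LNo p n k)
  construction p p-enum n k@(suc k-1) 1≤n 1≤k = automaton , ≤-reflexive states≡ , accepts-yes , rejects-no
    where
    B = 24 * ((n + k) * ⌊log₂ (n + k) ⌋)
    p≤B : ∀ {i} → i < k → p (n + i) ≤ B
    p≤B = window-prime-≤ p-enum 1≤n 1≤k
    instance
      B≢0 : NonZero B
      B≢0 = >-nonZero (≤-trans (≤-trans (s≤s z≤n) (2≤nth-prime p-enum 1≤n+0)) (p≤B z<s))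
        where 1≤n+0 = ≤-trans 1≤n (m≤m+n n 0)
    open WindowAutomaton p p-enum n 1≤n {k-1} {pred B}
      (λ i i<k → subst (p (n + i) ≤_) (sym (suc-pred B)) (p≤B i<k))
    regroup : ∀ k N L → k * (24 * (N * L)) ≡ 24 * (k * N * L)
    regroup = solve-∀
    states≡ : k * suc (pred B) ≡ 24 * (k * (n + k) * ⌊log₂ (n + k) ⌋)
    states≡ = trans (cong (k *_) (suc-pred B)) (regroup k (n + k) ⌊log₂ (n + k) ⌋)
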